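{- (a) For every $m\ge1$, the toroidal $(1,m)$-grid is periodic at time $m$; if $m=2\ell$ is even, then for every $i\in\mathbb{Z}_m$ there is perfect state transfer from vertex $(0,i)$ to vertex $(0,i+\ell)$ at time $\ell$. (b) For the toroidal $(2,m)$-grid: if $m$ is even, the map is periodic at time $m$; if $m$ is odd, then for every $i\in\mathbb{Z}_m$ there is perfect state transfer from vertex $(0,i)$ to vertex $(1,i)$ at time $m$, and the map is periodic at time $2m$.
   Context: For positive integers $n,m$, the toroidal $(n,m)$-grid is the orientable map (of genus 1) with vertex set $\mathbb{Z}_n\times\mathbb{Z}_m$ and edge set $\{w_R,w_D: w\in \mathbb{Z}_n\times\mathbb{Z}_m\}$, where $(a,b)_R$ joins $(a,b)$ and $(a,b+1)$ and $(a,b)_D$ joins $(a,b)$ and $(a+1,b)$ (indices modulo $n$ and $m$; edges may be loops or parallel), and the clockwise rotation at $(a,b)$ is $((a,b)_R,(a,b)_D,(a,b-1)_R,(a-1,b)_D)$. For an orientable map with vertex set $V$ and face set $F$: each edge gives two arcs on opposite sides, pointing in opposite directions, each lying in a face and oriented along its clockwise facial walk; $\mathcal A$ is the arc set, $v(a)$, $f(a)$ the tail vertex and face of $a$; $N\in\{0,1\}^{\mathcal A\times V}$ with $N(a,w)=1$ iff $w=v(a)$, $M\in\{0,1\}^{\mathcal A\times F}$ with $M(a,f)=1$ iff $f=f(a)$, $D=N^TN$, $\Delta=M^TM$, $\hat N=ND^{ -1/2}$, $\hat M=M\Delta^{ -1/2}$, $Q=\hat N\hat N^T$, $P=\hat M\hat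 M^T$, $U=(2P-I)(2Q-I)$. For distinct vertices $u,v$ of equal degree there is perfect state transfer from $u$ to $v$ at time $\tau$ if $U^\tau\hat Ne_u=\hat Ne_v$ ($e_w$ the standard basis vector of $\mathbb{C}^V$); the map is periodic at time $\tau$ if $U^\tau\hat N=\hat N$. -}

module Defs where

open import Data.Nat as ℕ using (ℕ; zero; suc)
open import Data.Nat.DivMod using (_mod_)
open import Data.Fin as Fin using (Fin; toℕ)
open import Data.Fin.Properties using () renaming (_≟_ to _≟F_)
open import Data.Product using (_×_; _,_)
open import Data.List using (List; []; _∷_; concatMap; map; foldr; allFin)
open import Data.Bool using (Bool; true; false; if_then_else_; _∧_; _∨_)
open import Relation.Nullary.Decidable using (⌊_⌋)
open import Relation.Binary.PropositionalEquality using (_≡_; _≢_)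
open import Data.Integer using (+_)
open import Data.Rational using (ℚ; 0ℚ; 1ℚ; _+_; _*_; _-_; _/_)

cycInc : ∀ {n} → Fin n → Fin n
cycInc {suc k} i = suc (toℕ i) mod suc k

cycDec : ∀ {n} → Fin n → Fin n
cycDec {suc k} i = (toℕ i ℕ.+ k) mod suc k

cycAdd : ∀ {n} → Fin n → ℕ → Fin n
cycAdd {suc k} i l = (toℕ i ℕ.+ l) mod suc k

Vertex : ℕ → ℕ → Set
Vertex n m = Fin n × Fin m

right down left up : ∀ {n m} → Vertex n m → Vertex n m
right (a , b) = (a , cycInc b)
down  (a , b) = (cycInc a , b)
left  (a , b) = (a , cycDec b)
up    (a , b) = (cycDec a , b)

-- edge (a,b)_R joins (a,b),(a,b+1); edge (a,b)_D joins (a,b),(a+1,b)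
data Dir : Set where
  R D : Dir

-- the two arcs of an edge w_d: fwd has tail w, bwd has tail the other end
data Side : Set where
  fwd bwd : Side

Arc : ℕ → ℕ → Set
Arc n m = Vertex n m × Dir × Side

allArcs : (n m : ℕ) → List (Arc n m)
allArcs n m =
  concatMap (λ a → concatMap (λ b → concatMap (λ d → map (λ s → ((a , b) , d , s))
    (fwd ∷ bwd ∷ [])) (R ∷ D ∷ [])) (allFin m)) (allFin n)

tailV : ∀ {n m} → Arc n m → Vertex n m
tailV (w , _ , fwd) = w
tailV (w , R , bwd) = right w
tailV (w , D , bwd) = down w

rev : ∀ {n m} → Arc n m → Arc n m
rev (w , d , fwd) = (w , d , bwd)
rev (w , d , bwd) = (w , d , fwd)

-- Clockwise rotation at x (as arcs with tail x):
--   position 0: (x , R , fwd)        [x_R]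
--   position 1: (x , D , fwd)        [x_D]
--   position 2: (left x , R , bwd)   [(a,b-1)_R]
--   position 3: (up x , D , bwd)     [(a-1,b)_D]
-- rotCW is the clockwise successor, rotCCW the clockwise predecessor.
rotCW : ∀ {n m} → Arc n m → Arc n m
rotCW (w , R , fwd) = (w , D , fwd)
rotCW (w , D , fwd) = (left w , R , bwd)
rotCW (w , R , bwd) = (up (right w) , D , bwd)
rotCW (w , D , bwd) = (down w , R , fwd)

rotCCW : ∀ {n m} → Arc n m → Arc n m
rotCCW (w , R , fwd) = (up w , D , bwd)
rotCCW (w , D , fwd) = (w , R , fwd)
rotCCW (w , R , bwd) = (right w , D , fwd)
rotCCW (w , D , bwd) = (left (down w) , R , bwd)

-- next arc along the clockwise facial walk: after arriving at the head of a,
-- leave along the clockwise predecessor (in the rotation) of the reversed arc.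
faceNext : ∀ {n m} → Arc n m → Arc n m
faceNext a = rotCCW (rev a)

_==V_ : ∀ {n m} → Vertex n m → Vertex n m → Bool
(a , b) ==V (a' , b') = ⌊ a ≟F a' ⌋ ∧ ⌊ b ≟F b' ⌋

_==Dir_ : Dir → Dir → Bool
R ==Dir R = true
D ==Dir D = true
_ ==Dir _ = false

_==S_ : Side → Side → Bool
fwd ==S fwd = true
bwd ==S bwd = true
_ ==S _ = false

_==A_ : ∀ {n m} → Arc n m → Arc n m → Bool
(w , d , s) ==A (w' , d' , s') = (w ==V w') ∧ ((d ==Dir d') ∧ (s ==S s'))

-- Faces: orbits of faceNext.  f(a) = f(b) iff b = faceNext^k a for some k
-- (k < number of arcs suffices since faceNext is a permutation).

iter : ∀ {A : Set} → ℕ → (A → A) → A → A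
iter zero f x = x
iter (suc k) f x = f (iter k f x)

anyBelow : ℕ → (ℕ → Bool) → Bool
anyBelow zero p = false
anyBelow (suc k) p = p k ∨ anyBelow k p

numArcs : ℕ → ℕ → ℕ
numArcs n m = 4 ℕ.* (n ℕ.* m)

sameFace : ∀ {n m} → Arc n m → Arc n m → Bool
sameFace {n} {m} a b = anyBelow (numArcs n m) (λ k → iter k faceNext a ==A b)

count : ∀ {A : Set} → (A → Bool) → List A → ℕ
count p = foldr (λ x r → if p x then suc r else r) 0

faceDeg : ∀ {n m} → Arc n m → ℕ
faceDeg {n} {m} a = count (sameFace a) (allArcs n m)

vDeg : ∀ {n m} → Vertex n m → ℕ
vDeg {n} {m} w = count (λ b → tailV b ==V w) (allArcs n m)

inv : ℕ → ℚ
inv zero = 0ℚ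
inv (suc k) = + 1 / suc k

sumQ : List ℚ → ℚ
sumQ = foldr _+_ 0ℚ

ArcVec : ℕ → ℕ → Set
ArcVec n m = Arc n m → ℚ

ArcMat : ℕ → ℕ → Set
ArcMat n m = Arc n m → Arc n m → ℚ

applyM : ∀ {n m} → ArcMat n m → ArcVec n m → ArcVec n m
applyM {n} {m} A v a = sumQ (map (λ b → A a b * v b) (allArcs n m))

-- P = M Δ⁻¹ Mᵀ entrywise: P(a,b) = [f(a)=f(b)] / deg f(a)
Pmat : ∀ {n m} → ArcMat n m
Pmat a b = if sameFace a b then inv (faceDeg a) else 0ℚ

-- Q = N D⁻¹ Nᵀ entrywise: Q(a,b) = [v(a)=v(b)] / deg v(a)
Qmat : ∀ {n m} → ArcMat n m
Qmat a b = if tailV a ==V tailV b then inv (vDeg (tailV a)) else 0ℚ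

refl2 : ∀ {n m} → ArcMat n m → ArcVec n m → ArcVec n m
refl2 A v a = (1ℚ + 1ℚ) * applyM A v a - v a

Uapply : ∀ {n m} → ArcVec n m → ArcVec n m
Uapply v = refl2 Pmat (refl2 Qmat v)

Upow : ∀ {n m} → ℕ → ArcVec n m → ArcVec n m
Upow τ = iter τ Uapply

Ncol : ∀ {n m} → Vertex n m → ArcVec n m
Ncol w a = if tailV a ==V w then 1ℚ else 0ℚ

-- Since N̂ e_w = deg(w)^{-1/2} N e_w and U^τ is linear, for deg u = deg v
-- the condition U^τ N̂ e_u = N̂ e_v is equivalent to U^τ N e_u = N e_v,
-- and U^τ N̂ = N̂ is equivalent to U^τ N e_w = N e_w for all w.

PST : ∀ {n m} → ℕ → Vertex n m → Vertex n m → Set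
PST {n} {m} τ u v =
  (u ≢ v) × (vDeg u ≡ vDeg v) × (∀ (a : Arc n m) → Upow τ (Ncol u) a ≡ Ncol v a)

Periodic : ℕ → ℕ → ℕ → Set
Periodic n m τ = ∀ (w : Vertex n m) (a : Arc n m) → Upow τ (Ncol w) a ≡ Ncol w a

{-# OPTIONS --safe #-}
module Submission where

-- Every vertex of the torus has degree 4 and every face is a quadrangle, so 2Q − I and 2P − I
-- replace the value on an arc by half the sum over its vertex star (resp. its face) minus the
-- value itself.  On a torus of height 1 or 2 the vector N e_w splits into an eastward wave E, a
-- westward wave W and a standing wave S that U negates:
--   U^t N e_w = E(right^t w) + W(left^t w) + (−1)^t S(w),   N e_(down w) = E(w) + W(w) − S(w).
-- The one-step identities behind this are identities between formal sums of arcs of the cover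
-- Bool × ℤ of the torus; they are checked once by normalisation and hold for every m.  In height 2
-- this gives periodicity when right^t = id and t is even, and transfer to the other row when t is
-- odd.  In height 1 the two decompositions coincide, so S = 0, and after m/2 steps both waves sit
-- at the antipodal vertex.

open import Data.Bool using (Bool; true; false; not; _∧_; _∨_; if_then_else_)
open import Data.Bool.ListAction using (any)
open import Data.Bool.Properties using (∨-zeroʳ; ∧-comm; ∧-assoc; ⇔→≡; not-involutive) renaming (_≟_ to _≟B_)
open import Data.Empty using (⊥-elim)
open import Data.Fin as Fin using (Fin; toℕ; zero; suc)
open import Data.Fin.Properties using (toℕ-fromℕ<; toℕ-injective; toℕ<n; suc-injective) renaming (_≟_ to _≟F_)
open import Data.Integer as ℤ using (ℤ; +_; -[1+_])
open import Data.Integer.Properties using () renaming (_≟_ to _≟ℤ_)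
open import Data.List using (List; []; _∷_; _++_; map; concatMap; foldr; concat; tabulate; allFin; length)
open import Data.List.Membership.Propositional using (_∈_)
open import Data.List.Properties using (map-++; map-tabulate)
open import Data.List.Relation.Unary.All using (All; []; _∷_)
open import Data.List.Relation.Unary.All.Properties using (All¬⇒¬Any)
open import Data.List.Relation.Unary.Any using (here; there)
open import Data.List.Relation.Unary.Unique.Propositional using (Unique; []; _∷_)
open import Data.Nat as ℕ using (ℕ; zero; suc; _%_; _<_; _≤_; _*_; s≤s; z≤n)
open import Data.Nat.DivMod using (%-distribˡ-+; m%n%n≡m%n; [m+n]%n≡m%n; m<n⇒m%n≡m; m≡m%n+[m/n]*n)
open import Data.Nat.Divisibility using (_∣_; divides; m∣m*n)
import Data.Nat.Properties as ℕₚ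
open import Data.Product using (_×_; _,_; proj₁; proj₂; ∃-syntax; map₁; map₂)
open import Data.Product.Properties using (≡-dec)
open import Data.Rational as ℚ using (ℚ; 0ℚ; 1ℚ; -_; _/_)
import Data.Rational.Properties as ℚₚ
open import Data.Rational.Solver using (module +-*-Solver)
open import Function using (_∘_; case_of_)
open import Function.Bundles using (mk⇔)
open import Relation.Binary.Definitions using (DecidableEquality)
open import Relation.Binary.PropositionalEquality
open import Relation.Nullary using (yes; no; ¬_)
open import Relation.Nullary.Decidable using (⌊_⌋)

open import Defs

open +-*-Solver using (solve; _:=_; _:+_; _:*_; :-_; con)
open ≡-Reasoning

iter-+ : ∀ {A : Set} (f : A → A) k j x → iter (k ℕ.+ j) f x ≡ iter k f (iter j f x)
iter-+ f zero    j x = refl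
iter-+ f (suc k) j x = cong f (iter-+ f k j x)

iter-suc : ∀ {A : Set} (f : A → A) k x → iter (suc k) f x ≡ iter k f (f x)
iter-suc f zero    x = refl
iter-suc f (suc k) x = cong f (iter-suc f k x)

iter-inverse : ∀ {A : Set} {f g : A → A} → (∀ x → g (f x) ≡ x) →
               ∀ k x → iter k g (iter k f x) ≡ x
iter-inverse gf zero    x = refl
iter-inverse {f = f} {g} gf (suc k) x = begin
  iter (suc k) g (f (iter k f x)) ≡⟨ iter-suc g k _ ⟩
  iter k g (g (f (iter k f x)))   ≡⟨ cong (iter k g) (gf _) ⟩
  iter k g (iter k f x)           ≡⟨ iter-inverse gf k x ⟩
  x                               ∎

iter-inverse-half : ∀ {A : Set} {f g : A → A} → (∀ x → g (f x) ≡ x) →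
                    ∀ k x → iter (k ℕ.+ k) f x ≡ x → iter k g x ≡ iter k f x
iter-inverse-half {f = f} {g} gf k x period = begin
  iter k g x                           ≡⟨ cong (iter k g) period ⟨
  iter k g (iter (k ℕ.+ k) f x)        ≡⟨ cong (iter k g) (iter-+ f k k x) ⟩
  iter k g (iter k f (iter k f x))     ≡⟨ iter-inverse gf k (iter k f x) ⟩
  iter k f x                           ∎

iter-periodic-* : ∀ {A : Set} (f : A → A) k → (∀ x → iter k f x ≡ x) → ∀ j x → iter (j ℕ.* k) f x ≡ x
iter-periodic-* f k p zero    x = refl
iter-periodic-* f k p (suc j) x =
  trans (iter-+ f k (j ℕ.* k) x) (trans (cong (iter k f) (iter-periodic-* f k p j x)) (p x))

module _ {A : Set} (p : A → Bool) where

  count-++ : ∀ xs ys → count p (xs ++ ys) ≡ count p xs ℕ.+ count p ys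
  count-++ [] ys = refl
  count-++ (x ∷ xs) ys with p x
  ... | true  = cong suc (count-++ xs ys)
  ... | false = count-++ xs ys

  count-concat-tabulate-0 : ∀ {k} (f : Fin k → List A) → (∀ i → count p (f i) ≡ 0) → count p (concat (tabulate f)) ≡ 0
  count-concat-tabulate-0 {zero} f z = refl
  count-concat-tabulate-0 {suc k} f z =
    trans (count-++ (f Fin.zero) _) (cong₂ ℕ._+_ (z Fin.zero) (count-concat-tabulate-0 (f ∘ Fin.suc) (z ∘ Fin.suc)))

  count-concat-tabulate : ∀ {k} (f : Fin k → List A) j → (∀ i → j ≢ i → count p (f i) ≡ 0) →
                          count p (concat (tabulate f)) ≡ count p (f j)
  count-concat-tabulate f Fin.zero z = trans (count-++ (f Fin.zero) _)
    (trans (cong (count p (f Fin.zero) ℕ.+_) (count-concat-tabulate-0 (f ∘ Fin.suc) (λ i → z (Fin.suc i) λ ())))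
           (ℕₚ.+-identityʳ _))
  count-concat-tabulate f (Fin.suc j) z = trans (count-++ (f Fin.zero) _)
    (cong₂ ℕ._+_ (z Fin.zero λ ()) (count-concat-tabulate (f ∘ Fin.suc) j (λ i j≢i → z (Fin.suc i) (j≢i ∘ suc-injective))))

  count-cong : ∀ {q : A → Bool} → (∀ x → p x ≡ q x) → ∀ xs → count p xs ≡ count q xs
  count-cong e [] = refl
  count-cong e (x ∷ xs) rewrite e x | count-cong e xs = refl

  count-∨ : ∀ (q : A → Bool) → (∀ b → p b ≡ true → q b ≡ false) → ∀ xs →
            count (λ b → p b ∨ q b) xs ≡ count p xs ℕ.+ count q xs
  count-∨ q disjoint [] = refl
  count-∨ q disjoint (x ∷ xs) with p x in px | q x in qx
  ... | true  | true  = case trans (sym qx) (disjoint x px) of λ ()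
  ... | true  | false = cong suc (count-∨ q disjoint xs)
  ... | false | true  = trans (cong suc (count-∨ q disjoint xs)) (sym (ℕₚ.+-suc _ _))
  ... | false | false = count-∨ q disjoint xs

concatMap-allFin : ∀ {A : Set} {k} (f : Fin k → List A) → concatMap f (allFin k) ≡ concat (tabulate f)
concatMap-allFin f = cong concat (map-tabulate (λ i → i) f)

≟F-refl : ∀ {k} (i : Fin k) → ⌊ i ≟F i ⌋ ≡ true
≟F-refl i with i ≟F i
... | yes _ = refl
... | no i≢i = ⊥-elim (i≢i refl)

≟F-≢ : ∀ {k} {i j : Fin k} → i ≢ j → ⌊ i ≟F j ⌋ ≡ false
≟F-≢ {i = i} {j} i≢j with i ≟F j
... | yes i≡j = ⊥-elim (i≢j i≡j)
... | no _ = refl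

anyBelow-sound : ∀ N p → anyBelow N p ≡ true → ∃[ k ] p k ≡ true
anyBelow-sound (suc N) p e with p N in pN
... | true  = N , pN
... | false = anyBelow-sound N p e

anyBelow-complete : ∀ N p {k} → k < N → p k ≡ true → anyBelow N p ≡ true
anyBelow-complete (suc N) p {k} k<1+N pk with k ℕ.≟ N
... | yes refl = cong (_∨ anyBelow N p) pk
... | no k≢N = trans (cong (p N ∨_) (anyBelow-complete N p (ℕₚ.≤∧≢⇒< (ℕₚ.≤-pred k<1+N) k≢N) pk)) (∨-zeroʳ (p N))

module _ {A : Set} where

  sumQ-map-+ : ∀ (f g : A → ℚ) xs → sumQ (map (λ x → f x ℚ.+ g x) xs) ≡ sumQ (map f xs) ℚ.+ sumQ (map g xs)
  sumQ-map-+ f g [] = refl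
  sumQ-map-+ f g (x ∷ xs) = trans (cong (f x ℚ.+ g x ℚ.+_) (sumQ-map-+ f g xs))
    (solve 4 (λ a b c d → (a :+ b) :+ (c :+ d) := (a :+ c) :+ (b :+ d)) refl (f x) (g x) _ _)

  sumQ-map-cong : ∀ {f g : A → ℚ} → (∀ x → f x ≡ g x) → ∀ xs → sumQ (map f xs) ≡ sumQ (map g xs)
  sumQ-map-cong e [] = refl
  sumQ-map-cong e (x ∷ xs) = cong₂ ℚ._+_ (e x) (sumQ-map-cong e xs)

odd : ℕ → Bool
odd zero = false
odd (suc t) = not (odd t)

odd-*2 : ∀ q → odd (q ℕ.* 2) ≡ false
odd-*2 zero = refl
odd-*2 (suc q) = trans (not-involutive (odd (q ℕ.* 2))) (odd-*2 q)

odd-even : ∀ {k} → 2 ∣ k → odd k ≡ false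
odd-even (divides q refl) = odd-*2 q

odd-¬even : ∀ {k} → ¬ (2 ∣ k) → odd k ≡ true
odd-¬even {k} ¬2∣k with odd k in e
... | true  = refl
... | false = ⊥-elim (¬2∣k (even k e))
  where
  even : ∀ k → odd k ≡ false → 2 ∣ k
  even zero _ = divides 0 refl
  even (suc zero) ()
  even (suc (suc k)) e with divides q eq ← even k (trans (sym (not-involutive (odd k))) e) =
    divides (suc q) (cong (2 ℕ.+_) eq)

module _ {n : ℕ} where

  toℕ-iter-cycInc : ∀ k (i : Fin (suc n)) → toℕ (iter k cycInc i) ≡ (toℕ i ℕ.+ k) % suc n
  toℕ-iter-cycInc zero i = sym (trans (cong (_% suc n) (ℕₚ.+-identityʳ (toℕ i))) (m<n⇒m%n≡m (toℕ<n i)))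
  toℕ-iter-cycInc (suc k) i = begin
    toℕ (cycInc (iter k cycInc i))        ≡⟨ toℕ-fromℕ< _ ⟩
    suc (toℕ (iter k cycInc i)) % suc n   ≡⟨ cong (λ r → suc r % suc n) (toℕ-iter-cycInc k i) ⟩
    (1 ℕ.+ x % suc n) % suc n             ≡⟨ %-distribˡ-+ 1 (x % suc n) (suc n) ⟩
    (1 % suc n ℕ.+ x % suc n % suc n) % suc n
      ≡⟨ cong (λ r → (1 % suc n ℕ.+ r) % suc n) (m%n%n≡m%n x (suc n)) ⟩
    (1 % suc n ℕ.+ x % suc n) % suc n     ≡⟨ %-distribˡ-+ 1 x (suc n) ⟨
    (1 ℕ.+ x) % suc n                     ≡⟨ cong (_% suc n) (ℕₚ.+-suc (toℕ i) k) ⟨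
    (toℕ i ℕ.+ suc k) % suc n             ∎
    where x = toℕ i ℕ.+ k

  iter-cycInc-period : ∀ (i : Fin (suc n)) → iter (suc n) cycInc i ≡ i
  iter-cycInc-period i = toℕ-injective (begin
    toℕ (iter (suc n) cycInc i)   ≡⟨ toℕ-iter-cycInc (suc n) i ⟩
    (toℕ i ℕ.+ suc n) % suc n     ≡⟨ [m+n]%n≡m%n (toℕ i) (suc n) ⟩
    toℕ i % suc n                 ≡⟨ m<n⇒m%n≡m (toℕ<n i) ⟩
    toℕ i                         ∎)

  cycAdd≡iter-cycInc : ∀ (i : Fin (suc n)) l → cycAdd i l ≡ iter l cycInc i
  cycAdd≡iter-cycInc i l = toℕ-injective (trans (toℕ-fromℕ< _) (sym (toℕ-iter-cycInc l i)))

cycInc-cycDec : ∀ {n} (i : Fin n) → cycInc (cycDec i) ≡ i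
cycInc-cycDec {suc n} i = trans (cong cycInc (cycAdd≡iter-cycInc i n)) (iter-cycInc-period i)

cycDec-cycInc : ∀ {n} (i : Fin n) → cycDec (cycInc i) ≡ i
cycDec-cycInc {suc n} i = begin
  cycDec (cycInc i)              ≡⟨ cycAdd≡iter-cycInc (cycInc i) n ⟩
  iter n cycInc (cycInc i)       ≡⟨ iter-suc cycInc n i ⟨
  iter (suc n) cycInc i          ≡⟨ iter-cycInc-period i ⟩
  i                              ∎

-- i + L ≡ i modulo 2L would make L a multiple of 2L.
cycAdd-half-≢ : ∀ l (i : Fin (2 ℕ.* suc l)) → i ≢ cycAdd i (suc l)
cycAdd-half-≢ l i eq = half-not-multiple ((toℕ i ℕ.+ L) ℕ./ N) (ℕₚ.+-cancelˡ-≡ (toℕ i) L _ (begin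
    toℕ i ℕ.+ L                                   ≡⟨ m≡m%n+[m/n]*n (toℕ i ℕ.+ L) N ⟩
    (toℕ i ℕ.+ L) % N ℕ.+ (toℕ i ℕ.+ L) ℕ./ N ℕ.* N  ≡⟨ cong (ℕ._+ (toℕ i ℕ.+ L) ℕ./ N ℕ.* N) (trans (cong toℕ eq) (toℕ-fromℕ< _)) ⟨
    toℕ i ℕ.+ (toℕ i ℕ.+ L) ℕ./ N ℕ.* N              ∎))
  where
  L = suc l
  N = 2 ℕ.* L
  half-not-multiple : ∀ q → L ≢ q ℕ.* N
  half-not-multiple (suc q) e = ℕₚ.m+1+n≢m L (sym (trans e (ℕₚ.+-assoc L (1 ℕ.* L) (q ℕ.* N))))

module _ {n m : ℕ} where

  left-right : ∀ (x : Vertex n m) → left (right x) ≡ x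
  left-right (a , b) = cong (a ,_) (cycDec-cycInc b)

  right-left : ∀ (x : Vertex n m) → right (left x) ≡ x
  right-left (a , b) = cong (a ,_) (cycInc-cycDec b)

  up-down : ∀ (x : Vertex n m) → up (down x) ≡ x
  up-down (a , b) = cong (_, b) (cycDec-cycInc a)

  down-up : ∀ (x : Vertex n m) → down (up x) ≡ x
  down-up (a , b) = cong (_, b) (cycInc-cycDec a)

  iter-right : ∀ k (a : Fin n) (b : Fin m) → iter k right (a , b) ≡ (a , iter k cycInc b)
  iter-right zero    a b = refl
  iter-right (suc k) a b = cong right (iter-right k a b)

  iter-right-period : ∀ (x : Vertex n m) → iter m right x ≡ x
  iter-right-period (a , b) = trans (iter-right m a b) (cong (a ,_) (period b))
    where
    period : ∀ {m} (b : Fin m) → iter m cycInc b ≡ b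
    period {suc m} = iter-cycInc-period

  iter-left-period : ∀ (x : Vertex n m) → iter m left x ≡ x
  iter-left-period x = trans (cong (iter m left) (sym (iter-right-period x))) (iter-inverse left-right m x)

-- Formal linear combinations

Formal : Set → Set
Formal A = List (ℚ × A)

½ : ℚ
½ = + 1 / 2

module _ {A : Set} where

  scale : ℚ → List A → Formal A
  scale c = map (c ,_)

  neg : Formal A → Formal A
  neg = map (map₁ -_)

  spread : (A → List A) → Formal A → Formal A
  spread col = concatMap (λ (c , x) → scale (c ℚ.* ½) (col x))

  -- reflect col L is the formal counterpart of (2M − I) L for the matrix M whose column x is
  -- ¼ times the indicator of the four arcs col x.
  reflect : (A → List A) → Formal A → Formal A
  reflect col L = spread col L ++ neg L

  ⟪_∣_⟫ : Formal A → (A → ℚ) → ℚ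
  ⟪ [] ∣ g ⟫ = 0ℚ
  ⟪ (c , x) ∷ L ∣ g ⟫ = c ℚ.* g x ℚ.+ ⟪ L ∣ g ⟫

  infix 4 _≈_
  record _≈_ (L L' : Formal A) : Set where
    constructor mk≈
    field
      ⟪⟫-≡ : ∀ g → ⟪ L ∣ g ⟫ ≡ ⟪ L' ∣ g ⟫

  open _≈_ public

  ⟪++⟫ : ∀ L L' g → ⟪ L ++ L' ∣ g ⟫ ≡ ⟪ L ∣ g ⟫ ℚ.+ ⟪ L' ∣ g ⟫
  ⟪++⟫ [] L' g = sym (ℚₚ.+-identityˡ _)
  ⟪++⟫ ((c , x) ∷ L) L' g =
    trans (cong (c ℚ.* g x ℚ.+_) (⟪++⟫ L L' g)) (sym (ℚₚ.+-assoc (c ℚ.* g x) _ _))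

  ⟪neg⟫ : ∀ L g → ⟪ neg L ∣ g ⟫ ≡ - ⟪ L ∣ g ⟫
  ⟪neg⟫ [] g = refl
  ⟪neg⟫ ((c , x) ∷ L) g = trans (cong (- c ℚ.* g x ℚ.+_) (⟪neg⟫ L g))
    (solve 3 (λ c y r → (:- c) :* y :+ (:- r) := :- (c :* y :+ r)) refl c (g x) ⟪ L ∣ g ⟫)

  ⟪∣⟫-cong : ∀ L {g h} → (∀ x → g x ≡ h x) → ⟪ L ∣ g ⟫ ≡ ⟪ L ∣ h ⟫
  ⟪∣⟫-cong [] e = refl
  ⟪∣⟫-cong ((c , x) ∷ L) e = cong₂ (λ y r → c ℚ.* y ℚ.+ r) (e x) (⟪∣⟫-cong L e)

  ⟪∣⟫-* : ∀ L k g → ⟪ L ∣ (λ x → k ℚ.* g x) ⟫ ≡ k ℚ.* ⟪ L ∣ g ⟫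
  ⟪∣⟫-* [] k g = sym (ℚₚ.*-zeroʳ k)
  ⟪∣⟫-* ((c , x) ∷ L) k g = trans (cong (c ℚ.* (k ℚ.* g x) ℚ.+_) (⟪∣⟫-* L k g))
    (solve 4 (λ c k y r → c :* (k :* y) :+ k :* r := k :* (c :* y :+ r)) refl c k (g x) ⟪ L ∣ g ⟫)

  ⟪∣⟫-− : ∀ L h g → ⟪ L ∣ (λ x → h x ℚ.- g x) ⟫ ≡ ⟪ L ∣ h ⟫ ℚ.- ⟪ L ∣ g ⟫
  ⟪∣⟫-− [] h g = refl
  ⟪∣⟫-− ((c , x) ∷ L) h g = trans (cong (c ℚ.* (h x ℚ.- g x) ℚ.+_) (⟪∣⟫-− L h g))
    (solve 5 (λ c y z r s → c :* (y :+ (:- z)) :+ (r :+ (:- s)) := c :* y :+ r :+ (:- (c :* z :+ s)))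
      refl c (h x) (g x) ⟪ L ∣ h ⟫ ⟪ L ∣ g ⟫)

  ⟪scale⟫ : ∀ k xs g → ⟪ scale k xs ∣ g ⟫ ≡ k ℚ.* sumQ (map g xs)
  ⟪scale⟫ k [] g = sym (ℚₚ.*-zeroʳ k)
  ⟪scale⟫ k (x ∷ xs) g = trans (cong (k ℚ.* g x ℚ.+_) (⟪scale⟫ k xs g)) (sym (ℚₚ.*-distribˡ-+ k (g x) _))

  reflectᵀ : (A → List A) → (A → ℚ) → A → ℚ
  reflectᵀ col g x = ½ ℚ.* sumQ (map g (col x)) ℚ.- g x

  ⟪spread⟫ : ∀ col L g → ⟪ spread col L ∣ g ⟫ ≡ ⟪ L ∣ (λ x → ½ ℚ.* sumQ (map g (col x))) ⟫
  ⟪spread⟫ col [] g = refl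
  ⟪spread⟫ col ((c , x) ∷ L) g = begin
    ⟪ scale (c ℚ.* ½) (col x) ++ spread col L ∣ g ⟫
      ≡⟨ ⟪++⟫ (scale (c ℚ.* ½) (col x)) (spread col L) g ⟩
    ⟪ scale (c ℚ.* ½) (col x) ∣ g ⟫ ℚ.+ ⟪ spread col L ∣ g ⟫
      ≡⟨ cong₂ ℚ._+_ (trans (⟪scale⟫ (c ℚ.* ½) (col x) g) (ℚₚ.*-assoc c ½ _)) (⟪spread⟫ col L g) ⟩
    c ℚ.* (½ ℚ.* sumQ (map g (col x))) ℚ.+ ⟪ L ∣ (λ x → ½ ℚ.* sumQ (map g (col x))) ⟫ ∎

  ⟪reflect⟫ : ∀ col L g → ⟪ reflect col L ∣ g ⟫ ≡ ⟪ L ∣ reflectᵀ col g ⟫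
  ⟪reflect⟫ col L g = begin
    ⟪ spread col L ++ neg L ∣ g ⟫                        ≡⟨ ⟪++⟫ (spread col L) (neg L) g ⟩
    ⟪ spread col L ∣ g ⟫ ℚ.+ ⟪ neg L ∣ g ⟫                ≡⟨ cong₂ ℚ._+_ (⟪spread⟫ col L g) (⟪neg⟫ L g) ⟩
    ⟪ L ∣ (λ x → ½ ℚ.* sumQ (map g (col x))) ⟫ ℚ.- ⟪ L ∣ g ⟫ ≡⟨ ⟪∣⟫-− L _ g ⟨
    ⟪ L ∣ reflectᵀ col g ⟫                                 ∎

  ≈-++ : ∀ {L₁ L₂ L₁' L₂'} → L₁ ≈ L₁' → L₂ ≈ L₂' → L₁ ++ L₂ ≈ L₁' ++ L₂'
  ≈-++ {L₁} {L₂} {L₁'} {L₂'} (mk≈ e₁) (mk≈ e₂) = mk≈ λ g → begin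
    ⟪ L₁ ++ L₂ ∣ g ⟫              ≡⟨ ⟪++⟫ L₁ L₂ g ⟩
    ⟪ L₁ ∣ g ⟫ ℚ.+ ⟪ L₂ ∣ g ⟫      ≡⟨ cong₂ ℚ._+_ (e₁ g) (e₂ g) ⟩
    ⟪ L₁' ∣ g ⟫ ℚ.+ ⟪ L₂' ∣ g ⟫    ≡⟨ ⟪++⟫ L₁' L₂' g ⟨
    ⟪ L₁' ++ L₂' ∣ g ⟫            ∎

relabel : ∀ {A B : Set} → (A → B) → Formal A → Formal B
relabel f = map (map₂ f)

module _ {A B : Set} (f : A → B) where

  relabel-scale : ∀ c xs → relabel f (scale c xs) ≡ scale c (map f xs)
  relabel-scale c [] = refl
  relabel-scale c (x ∷ xs) = cong ((c , f x) ∷_) (relabel-scale c xs)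

  relabel-neg : ∀ L → relabel f (neg L) ≡ neg (relabel f L)
  relabel-neg [] = refl
  relabel-neg ((c , x) ∷ L) = cong ((- c , f x) ∷_) (relabel-neg L)

  module _ (col : A → List A) (col' : B → List B) (col-natural : ∀ x → col' (f x) ≡ map f (col x)) where

    relabel-spread : ∀ L → relabel f (spread col L) ≡ spread col' (relabel f L)
    relabel-spread [] = refl
    relabel-spread ((c , x) ∷ L) = begin
      relabel f (scale (c ℚ.* ½) (col x) ++ spread col L)            ≡⟨ map-++ (map₂ f) _ (spread col L) ⟩
      relabel f (scale (c ℚ.* ½) (col x)) ++ relabel f (spread col L)
        ≡⟨ cong₂ _++_ (trans (relabel-scale _ (col x)) (cong (scale _) (sym (col-natural x)))) (relabel-spread L) ⟩
      scale (c ℚ.* ½) (col' (f x)) ++ spread col' (relabel f L)      ∎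

    relabel-reflect : ∀ L → relabel f (reflect col L) ≡ reflect col' (relabel f L)
    relabel-reflect L =
      trans (map-++ (map₂ f) (spread col L) (neg L)) (cong₂ _++_ (relabel-spread L) (relabel-neg L))

relabel-++ : ∀ {A B : Set} (f : A → B) L L' → relabel f (L ++ L') ≡ relabel f L ++ relabel f L'
relabel-++ f = map-++ (map₂ f)

⟪map⟫ : ∀ {A B : Set} (f : A → B) L g → ⟪ relabel f L ∣ g ⟫ ≡ ⟪ L ∣ g ∘ f ⟫
⟪map⟫ f [] g = refl
⟪map⟫ f ((c , x) ∷ L) g = cong (c ℚ.* g (f x) ℚ.+_) (⟪map⟫ f L g)

≈-map : ∀ {A B : Set} (f : A → B) {L L'} → L ≈ L' → relabel f L ≈ relabel f L'
≈-map f {L} {L'} (mk≈ e) = mk≈ λ g → trans (⟪map⟫ f L g) (trans (e (g ∘ f)) (sym (⟪map⟫ f L' g)))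

module _ {A : Set} where

  ≈-refl : ∀ {L : Formal A} → L ≈ L
  ≈-refl = mk≈ λ g → refl

  ≈-sym : ∀ {L L' : Formal A} → L ≈ L' → L' ≈ L
  ≈-sym (mk≈ e) = mk≈ λ g → sym (e g)

  ≈-trans : ∀ {L L' L'' : Formal A} → L ≈ L' → L' ≈ L'' → L ≈ L''
  ≈-trans (mk≈ e) (mk≈ e') = mk≈ λ g → trans (e g) (e' g)

  ≈-neg : ∀ {L L' : Formal A} → L ≈ L' → neg L ≈ neg L'
  ≈-neg {L} {L'} (mk≈ e) = mk≈ λ g → trans (⟪neg⟫ L g) (trans (cong -_ (e g)) (sym (⟪neg⟫ L' g)))

  neg-involutive : ∀ (L : Formal A) → neg (neg L) ≈ L
  neg-involutive L = mk≈ λ g → trans (⟪neg⟫ (neg L) g)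
    (trans (cong -_ (⟪neg⟫ L g)) (solve 1 (λ x → :- (:- x) := x) refl ⟪ L ∣ g ⟫))

  module _ (col : A → List A) where

    reflect-≈ : ∀ {L L'} → L ≈ L' → reflect col L ≈ reflect col L'
    reflect-≈ {L} {L'} (mk≈ e) = mk≈ λ g → trans (⟪reflect⟫ col L g) (trans (e _) (sym (⟪reflect⟫ col L' g)))

    reflect-++ : ∀ L L' → reflect col (L ++ L') ≈ reflect col L ++ reflect col L'
    reflect-++ L L' = mk≈ λ g → begin
      ⟪ reflect col (L ++ L') ∣ g ⟫                               ≡⟨ ⟪reflect⟫ col (L ++ L') g ⟩
      ⟪ L ++ L' ∣ reflectᵀ col g ⟫                                ≡⟨ ⟪++⟫ L L' _ ⟩
      ⟪ L ∣ reflectᵀ col g ⟫ ℚ.+ ⟪ L' ∣ reflectᵀ col g ⟫          ≡⟨ cong₂ ℚ._+_ (⟪reflect⟫ col L g) (⟪reflect⟫ col L' g) ⟨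
      ⟪ reflect col L ∣ g ⟫ ℚ.+ ⟪ reflect col L' ∣ g ⟫            ≡⟨ ⟪++⟫ (reflect col L) (reflect col L') g ⟨
      ⟪ reflect col L ++ reflect col L' ∣ g ⟫                     ∎

    reflect-neg : ∀ L → reflect col (neg L) ≈ neg (reflect col L)
    reflect-neg L = mk≈ λ g → begin
      ⟪ reflect col (neg L) ∣ g ⟫   ≡⟨ ⟪reflect⟫ col (neg L) g ⟩
      ⟪ neg L ∣ reflectᵀ col g ⟫    ≡⟨ ⟪neg⟫ L _ ⟩
      - ⟪ L ∣ reflectᵀ col g ⟫      ≡⟨ cong -_ (⟪reflect⟫ col L g) ⟨
      - ⟪ reflect col L ∣ g ⟫       ≡⟨ ⟪neg⟫ (reflect col L) g ⟨
      ⟪ neg (reflect col L) ∣ g ⟫   ∎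

signed : ∀ {A : Set} → Bool → Formal A → Formal A
signed false L = L
signed true  L = neg L

signed-≈ : ∀ {A : Set} b {L L' : Formal A} → L ≈ L' → signed b L ≈ signed b L'
signed-≈ false e = e
signed-≈ true  e = ≈-neg e

signed-neg : ∀ {A : Set} b (L : Formal A) → signed b (neg L) ≈ signed (not b) L
signed-neg false L = ≈-refl
signed-neg true  L = neg-involutive L

x+[y+s]≡x+[y-s]⇒s≡0 : ∀ x y s → x ℚ.+ (y ℚ.+ s) ≡ x ℚ.+ (y ℚ.+ - s) → s ≡ 0ℚ
x+[y+s]≡x+[y-s]⇒s≡0 x y s e = begin
  s                                    ≡⟨ solve 3 (λ x y s → s := con ½ :* (x :+ (y :+ s) :+ (:- (x :+ (y :+ (:- s)))))) refl x y s ⟩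
  ½ ℚ.* (x ℚ.+ (y ℚ.+ s) ℚ.- r)        ≡⟨ cong (λ z → ½ ℚ.* (z ℚ.- r)) e ⟩
  ½ ℚ.* (r ℚ.- r)                      ≡⟨ solve 1 (λ r → con ½ :* (r :+ (:- r)) := con 0ℚ) refl r ⟩
  0ℚ                                   ∎
  where
  r : ℚ
  r = x ℚ.+ (y ℚ.+ - s)

self-negating-vanishes : ∀ {A : Set} (X Y S : Formal A) → X ++ Y ++ S ≈ X ++ Y ++ neg S → S ≈ []
self-negating-vanishes X Y S (mk≈ e) = mk≈ λ g → x+[y+s]≡x+[y-s]⇒s≡0 ⟪ X ∣ g ⟫ ⟪ Y ∣ g ⟫ ⟪ S ∣ g ⟫ (begin
  ⟪ X ∣ g ⟫ ℚ.+ (⟪ Y ∣ g ⟫ ℚ.+ ⟪ S ∣ g ⟫)       ≡⟨ ⟪++⟫₃ S g ⟨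
  ⟪ X ++ Y ++ S ∣ g ⟫                           ≡⟨ e g ⟩
  ⟪ X ++ Y ++ neg S ∣ g ⟫                       ≡⟨ ⟪++⟫₃ (neg S) g ⟩
  ⟪ X ∣ g ⟫ ℚ.+ (⟪ Y ∣ g ⟫ ℚ.+ ⟪ neg S ∣ g ⟫)   ≡⟨ cong (λ r → ⟪ X ∣ g ⟫ ℚ.+ (⟪ Y ∣ g ⟫ ℚ.+ r)) (⟪neg⟫ S g) ⟩
  ⟪ X ∣ g ⟫ ℚ.+ (⟪ Y ∣ g ⟫ ℚ.+ - ⟪ S ∣ g ⟫)     ∎)
  where
  ⟪++⟫₃ : ∀ Z g → ⟪ X ++ Y ++ Z ∣ g ⟫ ≡ ⟪ X ∣ g ⟫ ℚ.+ (⟪ Y ∣ g ⟫ ℚ.+ ⟪ Z ∣ g ⟫)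
  ⟪++⟫₃ Z g = trans (⟪++⟫ X (Y ++ Z) g) (cong (⟪ X ∣ g ⟫ ℚ.+_) (⟪++⟫ Y Z g))

module Normalise {A : Set} (_≟_ : DecidableEquality A) where

  insert : ℚ × A → Formal A → Formal A
  insert t [] = t ∷ []
  insert (c , x) ((c' , y) ∷ L) with x ≟ y
  ... | yes _ = (c ℚ.+ c' , y) ∷ L
  ... | no _  = (c' , y) ∷ insert (c , x) L

  dropZeros : Formal A → Formal A
  dropZeros [] = []
  dropZeros ((c , x) ∷ L) with c ℚₚ.≟ 0ℚ
  ... | yes _ = dropZeros L
  ... | no _  = (c , x) ∷ dropZeros L

  normalise : Formal A → Formal A
  normalise L = dropZeros (foldr insert [] L)

  ⟪insert⟫ : ∀ t L g → ⟪ insert t L ∣ g ⟫ ≡ ⟪ t ∷ L ∣ g ⟫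
  ⟪insert⟫ t [] g = refl
  ⟪insert⟫ (c , x) ((c' , y) ∷ L) g with x ≟ y
  ... | yes refl = solve 4 (λ c c' y r → (c :+ c') :* y :+ r := c :* y :+ (c' :* y :+ r)) refl c c' (g x) ⟪ L ∣ g ⟫
  ... | no _ = trans (cong (c' ℚ.* g y ℚ.+_) (⟪insert⟫ (c , x) L g))
    (solve 5 (λ c x c' y r → c' :* y :+ (c :* x :+ r) := c :* x :+ (c' :* y :+ r)) refl c (g x) c' (g y) ⟪ L ∣ g ⟫)

  ⟪dropZeros⟫ : ∀ L g → ⟪ dropZeros L ∣ g ⟫ ≡ ⟪ L ∣ g ⟫
  ⟪dropZeros⟫ [] g = refl
  ⟪dropZeros⟫ ((c , x) ∷ L) g with c ℚₚ.≟ 0ℚ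
  ... | yes refl = trans (⟪dropZeros⟫ L g)
    (sym (trans (cong (ℚ._+ ⟪ L ∣ g ⟫) (ℚₚ.*-zeroˡ (g x))) (ℚₚ.+-identityˡ _)))
  ... | no _ = cong (c ℚ.* g x ℚ.+_) (⟪dropZeros⟫ L g)

  ⟪collect⟫ : ∀ L g → ⟪ foldr insert [] L ∣ g ⟫ ≡ ⟪ L ∣ g ⟫
  ⟪collect⟫ [] g = refl
  ⟪collect⟫ ((c , x) ∷ L) g =
    trans (⟪insert⟫ (c , x) (foldr insert [] L) g) (cong (c ℚ.* g x ℚ.+_) (⟪collect⟫ L g))

  normalise-sound : ∀ L → normalise L ≈ L
  normalise-sound L = mk≈ λ g → trans (⟪dropZeros⟫ (foldr insert [] L) g) (⟪collect⟫ L g)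

  ≈-by-normalise : ∀ L L' → normalise (L ++ neg L') ≡ [] → L ≈ L'
  ≈-by-normalise L L' e = mk≈ λ g → begin
    ⟪ L ∣ g ⟫                                   ≡⟨ solve 2 (λ l l' → l := (l :+ (:- l')) :+ l') refl ⟪ L ∣ g ⟫ ⟪ L' ∣ g ⟫ ⟩
    (⟪ L ∣ g ⟫ ℚ.+ - ⟪ L' ∣ g ⟫) ℚ.+ ⟪ L' ∣ g ⟫   ≡⟨ cong (λ r → (⟪ L ∣ g ⟫ ℚ.+ r) ℚ.+ ⟪ L' ∣ g ⟫) (⟪neg⟫ L' g) ⟨
    (⟪ L ∣ g ⟫ ℚ.+ ⟪ neg L' ∣ g ⟫) ℚ.+ ⟪ L' ∣ g ⟫ ≡⟨ cong (ℚ._+ ⟪ L' ∣ g ⟫) (⟪++⟫ L (neg L') g) ⟨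
    ⟪ L ++ neg L' ∣ g ⟫ ℚ.+ ⟪ L' ∣ g ⟫           ≡⟨ cong (ℚ._+ ⟪ L' ∣ g ⟫) (⟪⟫-≡ (normalise-sound (L ++ neg L')) g) ⟨
    ⟪ normalise (L ++ neg L') ∣ g ⟫ ℚ.+ ⟪ L' ∣ g ⟫ ≡⟨ cong (λ N → ⟪ N ∣ g ⟫ ℚ.+ ⟪ L' ∣ g ⟫) e ⟩
    0ℚ ℚ.+ ⟪ L' ∣ g ⟫                            ≡⟨ ℚₚ.+-identityˡ _ ⟩
    ⟪ L' ∣ g ⟫                                   ∎

record Moves (V : Set) : Set where
  field
    east west south north : V → V

torus : ∀ {n m} → Moves (Vertex n m)
torus = record { east = right ; west = left ; south = down ; north = up }

module Arcs {V : Set} (G : Moves V) where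
  open Moves G

  tail : V × Dir × Side → V
  tail (w , _ , fwd) = w
  tail (w , R , bwd) = east w
  tail (w , D , bwd) = south w

  next : V × Dir × Side → V × Dir × Side
  next (w , R , fwd) = (east w , D , fwd)
  next (w , D , fwd) = (west (south w) , R , bwd)
  next (w , R , bwd) = (north w , D , bwd)
  next (w , D , bwd) = (w , R , fwd)

  face : V × Dir × Side → List (V × Dir × Side)
  face a = a ∷ next a ∷ next (next a) ∷ next (next (next a)) ∷ []

  eastArcs westArcs star : V → List (V × Dir × Side)
  eastArcs w = (west w , R , bwd) ∷ (w , D , fwd) ∷ []
  westArcs w = (w , R , fwd) ∷ (north w , D , bwd) ∷ []
  star w = eastArcs w ++ westArcs w

  evolve : Formal (V × Dir × Side) → Formal (V × Dir × Side)
  evolve L = reflect face (reflect (star ∘ tail) L)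

  evolve-≈ : ∀ {L L'} → L ≈ L' → evolve L ≈ evolve L'
  evolve-≈ = reflect-≈ face ∘ reflect-≈ (star ∘ tail)

  evolve-++ : ∀ L L' → evolve (L ++ L') ≈ evolve L ++ evolve L'
  evolve-++ L L' = ≈-trans (reflect-≈ face (reflect-++ (star ∘ tail) L L'))
                           (reflect-++ face (reflect (star ∘ tail) L) (reflect (star ∘ tail) L'))

  evolve-neg : ∀ L → evolve (neg L) ≈ neg (evolve L)
  evolve-neg L = ≈-trans (reflect-≈ face (reflect-neg (star ∘ tail) L)) (reflect-neg face (reflect (star ∘ tail) L))

  evolve-++₃ : ∀ L L' L'' → evolve (L ++ L' ++ L'') ≈ evolve L ++ evolve L' ++ evolve L''
  evolve-++₃ L L' L'' = ≈-trans (evolve-++ L (L' ++ L'')) (≈-++ (≈-refl {L = evolve L}) (evolve-++ L' L''))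

  evolve-signed : ∀ b L → evolve (signed b L) ≈ signed b (evolve L)
  evolve-signed false L = ≈-refl
  evolve-signed true  L = evolve-neg L

  eastWave westWave standingWave : V → Formal (V × Dir × Side)
  eastWave w = scale ½ (eastArcs w ++ eastArcs (south w))
  westWave w = scale ½ (westArcs w ++ westArcs (south w))
  standingWave w = scale ½ (star w) ++ scale (- ½) (star (south w))

record IsMovesHom {V W : Set} (G : Moves V) (H : Moves W) (f : V → W) : Set where
  private
    module G = Moves G
    module H = Moves H
  field
    east-hom  : ∀ x → f (G.east x) ≡ H.east (f x)
    west-hom  : ∀ x → f (G.west x) ≡ H.west (f x)
    south-hom : ∀ x → f (G.south x) ≡ H.south (f x)
    north-hom : ∀ x → f (G.north x) ≡ H.north (f x)

mapArc : ∀ {V W : Set} → (V → W) → V × Dir × Side → W × Dir × Side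
mapArc f (w , d , s) = (f w , d , s)

module Naturality {V W : Set} {G : Moves V} {H : Moves W} {f : V → W} (hom : IsMovesHom G H f) where
  open IsMovesHom hom
  private
    module G = Moves G
    module H = Moves H
    module AG = Arcs G
    module AH = Arcs H

  tail-natural : ∀ a → AH.tail (mapArc f a) ≡ f (AG.tail a)
  tail-natural (w , R , fwd) = refl
  tail-natural (w , D , fwd) = refl
  tail-natural (w , R , bwd) = sym (east-hom w)
  tail-natural (w , D , bwd) = sym (south-hom w)

  next-natural : ∀ a → AH.next (mapArc f a) ≡ mapArc f (AG.next a)
  next-natural (w , R , fwd) = cong (λ x → x , D , fwd) (sym (east-hom w))
  next-natural (w , D , fwd) = cong (λ x → x , R , bwd) (sym (trans (west-hom _) (cong H.west (south-hom w))))
  next-natural (w , R , bwd) = cong (λ x → x , D , bwd) (sym (north-hom w))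
  next-natural (w , D , bwd) = refl

  face-natural : ∀ a → AH.face (mapArc f a) ≡ map (mapArc f) (AG.face a)
  face-natural a = cong₂ (λ x y → mapArc f a ∷ x ∷ y) next¹ (cong₂ (λ x y → x ∷ y ∷ []) next² next³)
    where
    next¹ : AH.next (mapArc f a) ≡ mapArc f (AG.next a)
    next¹ = next-natural a
    next² : AH.next (AH.next (mapArc f a)) ≡ mapArc f (AG.next (AG.next a))
    next² = trans (cong AH.next next¹) (next-natural (AG.next a))
    next³ : AH.next (AH.next (AH.next (mapArc f a))) ≡ mapArc f (AG.next (AG.next (AG.next a)))
    next³ = trans (cong AH.next next²) (next-natural (AG.next (AG.next a)))

  eastArcs-natural : ∀ w → AH.eastArcs (f w) ≡ map (mapArc f) (AG.eastArcs w)
  eastArcs-natural w rewrite west-hom w = refl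

  westArcs-natural : ∀ w → AH.westArcs (f w) ≡ map (mapArc f) (AG.westArcs w)
  westArcs-natural w rewrite north-hom w = refl

  star-natural : ∀ w → AH.star (f w) ≡ map (mapArc f) (AG.star w)
  star-natural w = trans (cong₂ _++_ (eastArcs-natural w) (westArcs-natural w))
                         (sym (map-++ (mapArc f) (AG.eastArcs w) (AG.westArcs w)))

  evolve-natural : ∀ L → AH.evolve (relabel (mapArc f) L) ≡ relabel (mapArc f) (AG.evolve L)
  evolve-natural L = sym (begin
    relabel (mapArc f) (reflect AG.face (reflect (AG.star ∘ AG.tail) L))
      ≡⟨ relabel-reflect (mapArc f) AG.face AH.face face-natural (reflect (AG.star ∘ AG.tail) L) ⟩
    reflect AH.face (relabel (mapArc f) (reflect (AG.star ∘ AG.tail) L))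
      ≡⟨ cong (reflect AH.face) (relabel-reflect (mapArc f) _ (AH.star ∘ AH.tail) star∘tail-natural L) ⟩
    reflect AH.face (reflect (AH.star ∘ AH.tail) (relabel (mapArc f) L)) ∎)
    where
    star∘tail-natural : ∀ a → AH.star (AH.tail (mapArc f a)) ≡ map (mapArc f) (AG.star (AG.tail a))
    star∘tail-natural a = trans (cong AH.star (tail-natural a)) (star-natural (AG.tail a))

  private
    scale-natural : ∀ c xs {xs'} → xs' ≡ map (mapArc f) xs → scale c xs' ≡ relabel (mapArc f) (scale c xs)
    scale-natural c xs e = trans (cong (scale c) e) (sym (relabel-scale (mapArc f) c xs))

    doubled-natural : (arcs : V → List (V × Dir × Side)) (arcs' : W → List (W × Dir × Side)) →
                      (∀ w → arcs' (f w) ≡ map (mapArc f) (arcs w)) →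
                      ∀ w → arcs' (f w) ++ arcs' (H.south (f w)) ≡ map (mapArc f) (arcs w ++ arcs (G.south w))
    doubled-natural arcs arcs' nat w = begin
      arcs' (f w) ++ arcs' (H.south (f w))
        ≡⟨ cong₂ _++_ (nat w) (trans (cong arcs' (sym (south-hom w))) (nat (G.south w))) ⟩
      map (mapArc f) (arcs w) ++ map (mapArc f) (arcs (G.south w))
        ≡⟨ map-++ (mapArc f) (arcs w) (arcs (G.south w)) ⟨
      map (mapArc f) (arcs w ++ arcs (G.south w)) ∎

  eastWave-natural : ∀ w → AH.eastWave (f w) ≡ relabel (mapArc f) (AG.eastWave w)
  eastWave-natural w = scale-natural ½ _ (doubled-natural AG.eastArcs AH.eastArcs eastArcs-natural w)

  westWave-natural : ∀ w → AH.westWave (f w) ≡ relabel (mapArc f) (AG.westWave w)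
  westWave-natural w = scale-natural ½ _ (doubled-natural AG.westArcs AH.westArcs westArcs-natural w)

  standingWave-natural : ∀ w → AH.standingWave (f w) ≡ relabel (mapArc f) (AG.standingWave w)
  standingWave-natural w = sym (trans (map-++ (map₂ (mapArc f)) (scale ½ (AG.star w)) _) (sym (cong₂ _++_
    (scale-natural ½ (AG.star w) (star-natural w))
    (scale-natural (- ½) (AG.star (G.south w)) (trans (cong AH.star (sym (south-hom w))) (star-natural (G.south w)))))))

-- Degrees, faces and the walk matrix of the torus

module _ {n m : ℕ} where

  open Arcs (torus {n} {m}) public

  ==V-sound : ∀ (x y : Vertex n m) → (x ==V y) ≡ true → x ≡ y
  ==V-sound (a , b) (a' , b') e with a ≟F a' | b ≟F b' | e
  ... | yes refl | yes refl | _ = refl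

  ==V-refl : ∀ (x : Vertex n m) → (x ==V x) ≡ true
  ==V-refl (a , b) = cong₂ _∧_ (≟F-refl a) (≟F-refl b)

  -- Direction and side are compared before the vertex, so that arcs of different kinds are
  -- told apart by computation alone.
  δ : Arc n m → Arc n m → Bool
  δ (w , d , s) (w' , d' , s') = (d ==Dir d') ∧ ((s ==S s') ∧ (w ==V w'))

  δ-sound : ∀ x y → δ x y ≡ true → x ≡ y
  δ-sound (w , R , fwd) (w' , R , fwd) e = cong (_, R , fwd) (==V-sound w w' e)
  δ-sound (w , R , bwd) (w' , R , bwd) e = cong (_, R , bwd) (==V-sound w w' e)
  δ-sound (w , D , fwd) (w' , D , fwd) e = cong (_, D , fwd) (==V-sound w w' e)
  δ-sound (w , D , bwd) (w' , D , bwd) e = cong (_, D , bwd) (==V-sound w w' e)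
  δ-sound (w , R , fwd) (w' , R , bwd) ()
  δ-sound (w , R , bwd) (w' , R , fwd) ()
  δ-sound (w , D , fwd) (w' , D , bwd) ()
  δ-sound (w , D , bwd) (w' , D , fwd) ()
  δ-sound (w , R , _)   (w' , D , _)   ()
  δ-sound (w , D , _)   (w' , R , _)   ()

  δ-refl : ∀ x → δ x x ≡ true
  δ-refl (w , R , fwd) = ==V-refl w
  δ-refl (w , R , bwd) = ==V-refl w
  δ-refl (w , D , fwd) = ==V-refl w
  δ-refl (w , D , bwd) = ==V-refl w

  δ-≢ : ∀ {x y} → x ≢ y → δ x y ≡ false
  δ-≢ {x} {y} x≢y with δ x y in e
  ... | true  = ⊥-elim (x≢y (δ-sound x y e))
  ... | false = refl

  quad : Fin n → Fin m → List (Arc n m)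
  quad a b = concatMap (λ d → map (λ s → ((a , b) , d , s)) (fwd ∷ bwd ∷ [])) (R ∷ D ∷ [])

  count-δ-quad : ∀ x a b → count (δ x) (quad a b) ≡ (if proj₁ x ==V (a , b) then 1 else 0)
  count-δ-quad (w , R , fwd) a b = refl
  count-δ-quad (w , R , bwd) a b = refl
  count-δ-quad (w , D , fwd) a b = refl
  count-δ-quad (w , D , bwd) a b = refl

  count-δ-allArcs : ∀ x → count (δ x) (allArcs n m) ≡ 1
  count-δ-allArcs x@((a₀ , b₀) , _) = begin
    count (δ x) (allArcs n m)                   ≡⟨ cong (count (δ x)) (concatMap-allFin row) ⟩
    count (δ x) (concat (tabulate row))         ≡⟨ count-concat-tabulate (δ x) row a₀ other-row ⟩
    count (δ x) (row a₀)                        ≡⟨ cong (count (δ x)) (concatMap-allFin (quad a₀)) ⟩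
    count (δ x) (concat (tabulate (quad a₀)))   ≡⟨ count-concat-tabulate (δ x) (quad a₀) b₀ other-column ⟩
    count (δ x) (quad a₀ b₀)                    ≡⟨ count-δ-quad x a₀ b₀ ⟩
    (if (a₀ , b₀) ==V (a₀ , b₀) then 1 else 0)  ≡⟨ cong (if_then 1 else 0) (==V-refl (a₀ , b₀)) ⟩
    1                                           ∎
    where
    row : Fin n → List (Arc n m)
    row a = concatMap (quad a) (allFin m)
    other-column : ∀ b → b₀ ≢ b → count (δ x) (quad a₀ b) ≡ 0
    other-column b b₀≢b = trans (count-δ-quad x a₀ b) (cong₂ (λ p q → if p ∧ q then 1 else 0) (≟F-refl a₀) (≟F-≢ b₀≢b))
    other-row : ∀ a → a₀ ≢ a → count (δ x) (row a) ≡ 0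
    other-row a a₀≢a = trans (cong (count (δ x)) (concatMap-allFin (quad a)))
      (count-concat-tabulate-0 (δ x) (quad a) (λ b → trans (count-δ-quad x a b) (cong (λ p → if p ∧ _ then 1 else 0) (≟F-≢ a₀≢a))))

  _∈ᵇ_ : Arc n m → List (Arc n m) → Bool
  a ∈ᵇ Y = any (λ y → δ y a) Y

  ∈ᵇ-complete : ∀ {a Y} → a ∈ Y → a ∈ᵇ Y ≡ true
  ∈ᵇ-complete {a} {_ ∷ Y} (here refl) = cong (_∨ a ∈ᵇ Y) (δ-refl a)
  ∈ᵇ-complete (there p) = trans (cong (_ ∨_) (∈ᵇ-complete p)) (∨-zeroʳ _)

  ∈ᵇ-sound : ∀ {a} Y → a ∈ᵇ Y ≡ true → a ∈ Y
  ∈ᵇ-sound {a} (y ∷ Y) e with δ y a in δya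
  ... | true  = here (sym (δ-sound y a δya))
  ... | false = there (∈ᵇ-sound Y e)

  ∈ᵇ-≡ : ∀ {a Y b Z} → (a ∈ Y → b ∈ Z) → (b ∈ Z → a ∈ Y) → a ∈ᵇ Y ≡ b ∈ᵇ Z
  ∈ᵇ-≡ {Y = Y} {Z = Z} to from =
    ⇔→≡ (mk⇔ (∈ᵇ-complete ∘ to ∘ ∈ᵇ-sound Y) (∈ᵇ-complete ∘ from ∘ ∈ᵇ-sound Z))

  ∉-∈ᵇ : ∀ {a Y} → All (a ≢_) Y → a ∈ᵇ Y ≡ false
  ∉-∈ᵇ {a} {Y} a∉Y with a ∈ᵇ Y in e
  ... | true  = ⊥-elim (All¬⇒¬Any a∉Y (∈ᵇ-sound Y e))
  ... | false = refl

  𝟙[_] : Bool → ℚ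
  𝟙[ b ] = if b then 1ℚ else 0ℚ

  sum-δ-Unique : ∀ {Y} → Unique Y → ∀ a → sumQ (map (λ y → 𝟙[ δ y a ]) Y) ≡ 𝟙[ a ∈ᵇ Y ]
  sum-δ-Unique [] a = refl
  sum-δ-Unique {y ∷ Y} (y∉Y ∷ uY) a with δ y a in δya
  ... | true  = cong (1ℚ ℚ.+_) (trans (sum-δ-Unique uY a)
                  (cong 𝟙[_] (∉-∈ᵇ (subst (λ z → All (z ≢_) Y) (δ-sound y a δya) y∉Y))))
  ... | false = trans (ℚₚ.+-identityˡ _) (sum-δ-Unique uY a)

  count-∈ᵇ : ∀ {Y} → Unique Y → count (_∈ᵇ Y) (allArcs n m) ≡ length Y
  count-∈ᵇ [] = count-false (allArcs n m)
    where
    count-false : ∀ xs → count (λ _ → false) xs ≡ 0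
    count-false [] = refl
    count-false (_ ∷ xs) = count-false xs
  count-∈ᵇ {y ∷ Y} (y∉Y ∷ uY) = trans (count-∨ (δ y) (_∈ᵇ Y) disjoint (allArcs n m))
                                      (cong₂ ℕ._+_ (count-δ-allArcs y) (count-∈ᵇ uY))
    where
    disjoint : ∀ b → δ y b ≡ true → b ∈ᵇ Y ≡ false
    disjoint b δyb = ∉-∈ᵇ (subst (λ z → All (z ≢_) Y) (δ-sound y b δyb) y∉Y)

  tailV≡tail : ∀ a → tailV a ≡ tail a
  tailV≡tail (w , R , fwd) = refl
  tailV≡tail (w , D , fwd) = refl
  tailV≡tail (w , R , bwd) = refl
  tailV≡tail (w , D , bwd) = refl

  faceNext≡next : ∀ a → faceNext a ≡ next a
  faceNext≡next (w , R , fwd) = refl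
  faceNext≡next (w , D , fwd) = refl
  faceNext≡next (w , R , bwd) = refl
  faceNext≡next (w , D , bwd) = refl

  star-Unique : ∀ w → Unique (star w)
  star-Unique w = ((λ ()) ∷ (λ ()) ∷ (λ ()) ∷ []) ∷ ((λ ()) ∷ (λ ()) ∷ []) ∷ ((λ ()) ∷ []) ∷ [] ∷ []

  tail-star : ∀ b w → (tailV b ==V w) ≡ b ∈ᵇ star w
  tail-star b w = ⇔→≡ (mk⇔ (∈ᵇ-complete {b} {star w} ∘ tail-∈-star b ∘ ==V-sound (tailV b) w)
    (λ e → subst (λ z → (tailV b ==V z) ≡ true) (∈-star-tail (∈ᵇ-sound {b} (star w) e)) (==V-refl (tailV b))))
    where
    tail-∈-star : ∀ b → tailV b ≡ w → b ∈ star w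
    tail-∈-star (v , R , fwd) refl = there (there (here refl))
    tail-∈-star (v , D , fwd) refl = there (here refl)
    tail-∈-star (v , R , bwd) refl = here (cong (_, R , bwd) (sym (left-right v)))
    tail-∈-star (v , D , bwd) refl = there (there (there (here (cong (_, D , bwd) (sym (up-down v))))))
    ∈-star-tail : ∀ {b} → b ∈ star w → tailV b ≡ w
    ∈-star-tail (here refl) = right-left w
    ∈-star-tail (there (here refl)) = refl
    ∈-star-tail (there (there (here refl))) = refl
    ∈-star-tail (there (there (there (here refl)))) = down-up w

  next-period : ∀ a → next (next (next (next a))) ≡ a
  next-period ((a , b) , R , fwd) = cong (_, R , fwd) (cong₂ _,_ (cycDec-cycInc a) (cycDec-cycInc b))
  next-period ((a , b) , D , fwd) = cong (_, D , fwd) (cong₂ _,_ (cycDec-cycInc a) (cycInc-cycDec b))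
  next-period ((a , b) , R , bwd) = cong (_, R , bwd) (cong₂ _,_ (cycInc-cycDec a) (cycDec-cycInc b))
  next-period ((a , b) , D , bwd) = cong (_, D , bwd) (cong₂ _,_ (cycDec-cycInc a) (cycDec-cycInc b))

  face-Unique : ∀ a → Unique (face a)
  face-Unique (w , R , fwd) = ((λ ()) ∷ (λ ()) ∷ (λ ()) ∷ []) ∷ ((λ ()) ∷ (λ ()) ∷ []) ∷ ((λ ()) ∷ []) ∷ [] ∷ []
  face-Unique (w , D , fwd) = ((λ ()) ∷ (λ ()) ∷ (λ ()) ∷ []) ∷ ((λ ()) ∷ (λ ()) ∷ []) ∷ ((λ ()) ∷ []) ∷ [] ∷ []
  face-Unique (w , R , bwd) = ((λ ()) ∷ (λ ()) ∷ (λ ()) ∷ []) ∷ ((λ ()) ∷ (λ ()) ∷ []) ∷ ((λ ()) ∷ []) ∷ [] ∷ []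
  face-Unique (w , D , bwd) = ((λ ()) ∷ (λ ()) ∷ (λ ()) ∷ []) ∷ ((λ ()) ∷ (λ ()) ∷ []) ∷ ((λ ()) ∷ []) ∷ [] ∷ []

  face-sym : ∀ {a b} → b ∈ face a → a ∈ face b
  face-sym (here refl) = here refl
  face-sym {a} (there (here refl)) = there (there (there (here (sym (next-period a)))))
  face-sym {a} (there (there (here refl))) = there (there (here (sym (next-period a))))
  face-sym {a} (there (there (there (here refl)))) = there (here (sym (next-period a)))

  iter-next-∈-face : ∀ k a → iter k next a ∈ face a
  iter-next-∈-face 0 a = here refl
  iter-next-∈-face 1 a = there (here refl)
  iter-next-∈-face 2 a = there (there (here refl))
  iter-next-∈-face 3 a = there (there (there (here refl)))
  iter-next-∈-face (suc (suc (suc (suc k)))) a =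
    subst (_∈ face a) (sym (next-period (iter k next a))) (iter-next-∈-face k a)

  ∈-face-iter-next : ∀ {a b} → b ∈ face a → ∃[ k ] k < 4 × iter k next a ≡ b
  ∈-face-iter-next (here refl) = 0 , s≤s z≤n , refl
  ∈-face-iter-next (there (here refl)) = 1 , s≤s (s≤s z≤n) , refl
  ∈-face-iter-next (there (there (here refl))) = 2 , s≤s (s≤s (s≤s z≤n)) , refl
  ∈-face-iter-next (there (there (there (here refl)))) = 3 , ℕₚ.≤-refl , refl

  iter-faceNext : ∀ k a → iter k faceNext a ≡ iter k next a
  iter-faceNext zero a = refl
  iter-faceNext (suc k) a = trans (faceNext≡next _) (cong next (iter-faceNext k a))

  ==A≡δ : ∀ x y → (x ==A y) ≡ δ x y
  ==A≡δ (w , d , s) (w' , d' , s') = trans (∧-comm (w ==V w') _) (∧-assoc (d ==Dir d') (s ==S s') (w ==V w'))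

  sameFace-face : ∀ a b → sameFace a b ≡ b ∈ᵇ face a
  sameFace-face a b = ⇔→≡ (mk⇔ to from)
    where
    on-face : ∀ k → iter k faceNext a ≡ b → b ∈ face a
    on-face k e = subst (_∈ face a) (trans (sym (iter-faceNext k a)) e) (iter-next-∈-face k a)
    to : sameFace a b ≡ true → b ∈ᵇ face a ≡ true
    to e with k , hit ← anyBelow-sound (numArcs n m) (λ k → iter k faceNext a ==A b) e =
      ∈ᵇ-complete {b} {face a} (on-face k (δ-sound (iter k faceNext a) b (trans (sym (==A≡δ (iter k faceNext a) b)) hit)))
    4≤numArcs : ∀ {n m} → Vertex n m → 4 ≤ numArcs n m
    4≤numArcs {suc n} {suc m} _ = ℕₚ.m≤m*n 4 (suc n ℕ.* suc m)
    from : b ∈ᵇ face a ≡ true → sameFace a b ≡ true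
    from e with k , k<4 , hit ← ∈-face-iter-next (∈ᵇ-sound {b} (face a) e) =
      anyBelow-complete (numArcs n m) (λ k → iter k faceNext a ==A b) (ℕₚ.<-≤-trans k<4 (4≤numArcs (proj₁ a)))
        (trans (==A≡δ (iter k faceNext a) b) (subst (λ z → δ z b ≡ true) (sym (trans (iter-faceNext k a) hit)) (δ-refl b)))

  vDeg-4 : ∀ w → vDeg w ≡ 4
  vDeg-4 w = trans (count-cong (λ b → tailV b ==V w) (λ b → tail-star b w) (allArcs n m)) (count-∈ᵇ (star-Unique w))

  faceDeg-4 : ∀ a → faceDeg a ≡ 4
  faceDeg-4 a = trans (count-cong (sameFace a) (sameFace-face a) (allArcs n m)) (count-∈ᵇ (face-Unique a))

  two : ℚ
  two = 1ℚ ℚ.+ 1ℚ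

  double-quarter : ∀ b → two ℚ.* (if b then inv 4 else 0ℚ) ≡ ½ ℚ.* 𝟙[ b ]
  double-quarter true  = refl
  double-quarter false = refl

  Qmat-column : ∀ a x → two ℚ.* Qmat a x ≡ ½ ℚ.* sumQ (map (λ y → 𝟙[ δ y a ]) (star (tail x)))
  Qmat-column a x = begin
    two ℚ.* (if tailV a ==V tailV x then inv (vDeg (tailV a)) else 0ℚ)
      ≡⟨ cong (λ k → two ℚ.* (if tailV a ==V tailV x then inv k else 0ℚ)) (vDeg-4 (tailV a)) ⟩
    two ℚ.* (if tailV a ==V tailV x then inv 4 else 0ℚ)
      ≡⟨ double-quarter (tailV a ==V tailV x) ⟩
    ½ ℚ.* 𝟙[ tailV a ==V tailV x ]
      ≡⟨ cong (λ b → ½ ℚ.* 𝟙[ b ]) (trans (tail-star a (tailV x)) (cong (λ w → a ∈ᵇ star w) (tailV≡tail x))) ⟩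
    ½ ℚ.* 𝟙[ a ∈ᵇ star (tail x) ]
      ≡⟨ cong (½ ℚ.*_) (sum-δ-Unique (star-Unique (tail x)) a) ⟨
    ½ ℚ.* sumQ (map (λ y → 𝟙[ δ y a ]) (star (tail x))) ∎

  Pmat-column : ∀ a x → two ℚ.* Pmat a x ≡ ½ ℚ.* sumQ (map (λ y → 𝟙[ δ y a ]) (face x))
  Pmat-column a x = begin
    two ℚ.* (if sameFace a x then inv (faceDeg a) else 0ℚ)
      ≡⟨ cong (λ k → two ℚ.* (if sameFace a x then inv k else 0ℚ)) (faceDeg-4 a) ⟩
    two ℚ.* (if sameFace a x then inv 4 else 0ℚ)
      ≡⟨ double-quarter (sameFace a x) ⟩
    ½ ℚ.* 𝟙[ sameFace a x ]
      ≡⟨ cong (λ b → ½ ℚ.* 𝟙[ b ]) (trans (sameFace-face a x) (∈ᵇ-≡ {x} {face a} {a} {face x} face-sym face-sym)) ⟩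
    ½ ℚ.* 𝟙[ a ∈ᵇ face x ]
      ≡⟨ cong (½ ℚ.*_) (sum-δ-Unique (face-Unique x) a) ⟨
    ½ ℚ.* sumQ (map (λ y → 𝟙[ δ y a ]) (face x)) ∎

  vec : Formal (Arc n m) → ArcVec n m
  vec L a = ⟪ L ∣ (λ x → 𝟙[ δ x a ]) ⟫

  sum-δ-0 : ∀ (f : Arc n m → ℚ) x xs → count (δ x) xs ≡ 0 → sumQ (map (λ b → f b ℚ.* 𝟙[ δ x b ]) xs) ≡ 0ℚ
  sum-δ-0 f x [] _ = refl
  sum-δ-0 f x (b ∷ xs) c with δ x b | c
  ... | true  | ()
  ... | false | c' = trans (cong₂ ℚ._+_ (ℚₚ.*-zeroʳ (f b)) (sum-δ-0 f x xs c')) (ℚₚ.+-identityˡ 0ℚ)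

  sum-δ-1 : ∀ (f : Arc n m → ℚ) x xs → count (δ x) xs ≡ 1 → sumQ (map (λ b → f b ℚ.* 𝟙[ δ x b ]) xs) ≡ f x
  sum-δ-1 f x (b ∷ xs) c with δ x b in δxb
  ... | true  = begin
    f b ℚ.* 1ℚ ℚ.+ sumQ (map (λ b → f b ℚ.* 𝟙[ δ x b ]) xs) ≡⟨ cong₂ ℚ._+_ (ℚₚ.*-identityʳ (f b)) (sum-δ-0 f x xs (ℕₚ.suc-injective c)) ⟩
    f b ℚ.+ 0ℚ                                              ≡⟨ ℚₚ.+-identityʳ (f b) ⟩
    f b                                                     ≡⟨ cong f (δ-sound x b δxb) ⟨
    f x                                                     ∎
  ... | false = trans (cong (ℚ._+ _) (ℚₚ.*-zeroʳ (f b))) (trans (ℚₚ.+-identityˡ _) (sum-δ-1 f x xs c))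

  applyM-vec : ∀ (M : ArcMat n m) L a → applyM M (vec L) a ≡ ⟪ L ∣ M a ⟫
  applyM-vec M [] a = trans (sumQ-map-cong (λ b → ℚₚ.*-zeroʳ (M a b)) (allArcs n m)) (sum-0 (allArcs n m))
    where
    sum-0 : ∀ (xs : List (Arc n m)) → sumQ (map (λ _ → 0ℚ) xs) ≡ 0ℚ
    sum-0 [] = refl
    sum-0 (_ ∷ xs) = trans (ℚₚ.+-identityˡ _) (sum-0 xs)
  applyM-vec M ((c , x) ∷ L) a = begin
    sumQ (map (λ b → M a b ℚ.* (c ℚ.* 𝟙[ δ x b ] ℚ.+ vec L b)) (allArcs n m))
      ≡⟨ sumQ-map-cong (λ b → solve 4 (λ μ c e v → μ :* (c :* e :+ v) := μ :* c :* e :+ μ :* v) refl (M a b) c 𝟙[ δ x b ] (vec L b)) (allArcs n m) ⟩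
    sumQ (map (λ b → M a b ℚ.* c ℚ.* 𝟙[ δ x b ] ℚ.+ M a b ℚ.* vec L b) (allArcs n m))
      ≡⟨ sumQ-map-+ (λ b → M a b ℚ.* c ℚ.* 𝟙[ δ x b ]) (λ b → M a b ℚ.* vec L b) (allArcs n m) ⟩
    sumQ (map (λ b → M a b ℚ.* c ℚ.* 𝟙[ δ x b ]) (allArcs n m)) ℚ.+ applyM M (vec L) a
      ≡⟨ cong₂ ℚ._+_ (sum-δ-1 (λ b → M a b ℚ.* c) x (allArcs n m) (count-δ-allArcs x)) (applyM-vec M L a) ⟩
    M a x ℚ.* c ℚ.+ ⟪ L ∣ M a ⟫
      ≡⟨ cong (ℚ._+ ⟪ L ∣ M a ⟫) (ℚₚ.*-comm (M a x) c) ⟩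
    c ℚ.* M a x ℚ.+ ⟪ L ∣ M a ⟫ ∎

  refl2-reflect : ∀ (M : ArcMat n m) (col : Arc n m → List (Arc n m)) →
                  (∀ a x → two ℚ.* M a x ≡ ½ ℚ.* sumQ (map (λ y → 𝟙[ δ y a ]) (col x))) →
                  ∀ L → refl2 M (vec L) ≗ vec (reflect col L)
  refl2-reflect M col column L a = begin
    two ℚ.* applyM M (vec L) a ℚ.- vec L a                     ≡⟨ cong (λ r → two ℚ.* r ℚ.- vec L a) (applyM-vec M L a) ⟩
    two ℚ.* ⟪ L ∣ M a ⟫ ℚ.- vec L a                            ≡⟨ cong (ℚ._- vec L a) (⟪∣⟫-* L two (M a)) ⟨
    ⟪ L ∣ (λ x → two ℚ.* M a x) ⟫ ℚ.- vec L a                  ≡⟨ ⟪∣⟫-− L _ _ ⟨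
    ⟪ L ∣ (λ x → two ℚ.* M a x ℚ.- 𝟙[ δ x a ]) ⟫               ≡⟨ ⟪∣⟫-cong L (λ x → cong (ℚ._- 𝟙[ δ x a ]) (column a x)) ⟩
    ⟪ L ∣ reflectᵀ col (λ x → 𝟙[ δ x a ]) ⟫                    ≡⟨ ⟪reflect⟫ col L _ ⟨
    vec (reflect col L) a                                      ∎

  refl2-cong : ∀ (M : ArcMat n m) {v w} → v ≗ w → refl2 M v ≗ refl2 M w
  refl2-cong M v≗w a =
    cong₂ (λ r s → two ℚ.* r ℚ.- s) (sumQ-map-cong (λ b → cong (M a b ℚ.*_) (v≗w b)) (allArcs n m)) (v≗w a)

  Uapply-evolve : ∀ L → Uapply (vec L) ≗ vec (evolve L)
  Uapply-evolve L a = trans (refl2-cong Pmat (refl2-reflect Qmat (star ∘ tail) Qmat-column L) a)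
                            (refl2-reflect Pmat face Pmat-column (reflect (star ∘ tail) L) a)

  vec-≈ : ∀ {L L'} → L ≈ L' → vec L ≗ vec L'
  vec-≈ (mk≈ e) a = e (λ x → 𝟙[ δ x a ])

  Uapply-cong : ∀ {v w : ArcVec n m} → v ≗ w → Uapply v ≗ Uapply w
  Uapply-cong v≗w = refl2-cong Pmat (refl2-cong Qmat v≗w)

  Upow-cong : ∀ t {v w : ArcVec n m} → v ≗ w → Upow t v ≗ Upow t w
  Upow-cong zero    v≗w = v≗w
  Upow-cong (suc t) v≗w = Uapply-cong (Upow-cong t v≗w)

  Upow-vec : ∀ t L → Upow t (vec L) ≗ vec (iter t evolve L)
  Upow-vec zero L a = refl
  Upow-vec (suc t) L a = trans (Uapply-cong (Upow-vec t L) a) (Uapply-evolve (iter t evolve L) a)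

  Ncol-star : ∀ w → Ncol w ≗ vec (scale 1ℚ (star w))
  Ncol-star w a = begin
    (if tailV a ==V w then 1ℚ else 0ℚ)     ≡⟨ cong 𝟙[_] (tail-star a w) ⟩
    𝟙[ a ∈ᵇ star w ]                        ≡⟨ sum-δ-Unique (star-Unique w) a ⟨
    sumQ (map (λ y → 𝟙[ δ y a ]) (star w))  ≡⟨ ℚₚ.*-identityˡ _ ⟨
    1ℚ ℚ.* sumQ (map (λ y → 𝟙[ δ y a ]) (star w)) ≡⟨ ⟪scale⟫ 1ℚ (star w) (λ y → 𝟙[ δ y a ]) ⟨
    vec (scale 1ℚ (star w)) a               ∎

-- The cover Bool × ℤ

_≟Dir_ : DecidableEquality Dir
R ≟Dir R = yes refl
R ≟Dir D = no λ ()
D ≟Dir R = no λ ()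
D ≟Dir D = yes refl

_≟Side_ : DecidableEquality Side
fwd ≟Side fwd = yes refl
fwd ≟Side bwd = no λ ()
bwd ≟Side fwd = no λ ()
bwd ≟Side bwd = yes refl

-- (b , j) stands for the vertex j steps east of a base point, moved one row down when b holds.
-- On a torus where down is an involution this is a cover that does not depend on m, so identities
-- between formal sums over it hold on every such torus, even where distinct lifts collide.
Lift : Set
Lift = Bool × ℤ

lift : Moves Lift
lift = record { east = map₂ ℤ.suc ; west = map₂ ℤ.pred ; south = map₁ not ; north = map₁ not }

_≟Lift_ : DecidableEquality (Lift × Dir × Side)
_≟Lift_ = ≡-dec (≡-dec _≟B_ _≟ℤ_) (≡-dec _≟Dir_ _≟Side_)

origin : Lift
origin = (false , + 0)

module LiftedWaves where
  private
    module L = Arcs lift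
  open Normalise _≟Lift_
  open Moves lift

  eastWave-evolves : normalise (L.evolve (L.eastWave origin) ++ neg (L.eastWave (east origin))) ≡ []
  eastWave-evolves = refl

  westWave-evolves : normalise (L.evolve (L.westWave origin) ++ neg (L.westWave (west origin))) ≡ []
  westWave-evolves = refl

  standingWave-evolves : normalise (L.evolve (L.standingWave origin) ++ neg (neg (L.standingWave origin))) ≡ []
  standingWave-evolves = refl

  star-splits : normalise (scale 1ℚ (L.star origin) ++ neg (L.eastWave origin ++ L.westWave origin ++ L.standingWave origin)) ≡ []
  star-splits = refl

  star-south-splits : normalise (scale 1ℚ (L.star (south origin)) ++ neg (L.eastWave origin ++ L.westWave origin ++ neg (L.standingWave origin))) ≡ []
  star-south-splits = refl

-- Tori of height one or two

shift : ∀ {n m} → ℤ → Vertex n m → Vertex n m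
shift (+ k)    w = iter k right w
shift -[1+ k ] w = iter (suc k) left w

shift-suc : ∀ {n m} j (w : Vertex n m) → shift (ℤ.suc j) w ≡ right (shift j w)
shift-suc (+ k) w = refl
shift-suc -[1+ zero ] w = sym (right-left w)
shift-suc -[1+ suc k ] w = sym (right-left _)

shift-pred : ∀ {n m} j (w : Vertex n m) → shift (ℤ.pred j) w ≡ left (shift j w)
shift-pred (+ zero) w = refl
shift-pred (+ suc k) w = sym (left-right _)
shift-pred -[1+ k ] w = refl

flipDown : ∀ {n m} → Bool → Vertex n m → Vertex n m
flipDown b w = if b then down w else w

module HeightDividingTwo {n m : ℕ} (down-involutive : ∀ (x : Vertex n m) → down (down x) ≡ x) where

  module Cover (w : Vertex n m) where

    project : Lift → Vertex n m
    project (b , j) = flipDown b (shift j w)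

    project-hom : IsMovesHom lift torus project
    project-hom = record { east-hom = east-hom ; west-hom = west-hom ; south-hom = south-hom ; north-hom = north-hom }
      where
      east-hom : ∀ x → project (map₂ ℤ.suc x) ≡ right (project x)
      east-hom (false , j) = shift-suc j w
      east-hom (true , j) = cong down (shift-suc j w)
      west-hom : ∀ x → project (map₂ ℤ.pred x) ≡ left (project x)
      west-hom (false , j) = shift-pred j w
      west-hom (true , j) = cong down (shift-pred j w)
      south-hom : ∀ x → project (map₁ not x) ≡ down (project x)
      south-hom (false , j) = refl
      south-hom (true , j) = sym (down-involutive _)
      north-hom : ∀ x → project (map₁ not x) ≡ up (project x)
      north-hom x = trans (south-hom x) (sym (trans (cong up (sym (down-involutive _))) (up-down (down (project x)))))

    open Naturality project-hom public
    open Normalise _≟Lift_ public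

    P : Lift × Dir × Side → Arc n m
    P = mapArc project

    lifted : ∀ X Y → normalise (X ++ neg Y) ≡ [] → ∀ {L L'} → L ≡ relabel P X → L' ≡ relabel P Y → L ≈ L'
    lifted X Y e refl refl = ≈-map P (≈-by-normalise X Y e)

    star-lifts : ∀ k → scale 1ℚ (star (project k)) ≡ relabel P (scale 1ℚ (Arcs.star lift k))
    star-lifts k = trans (cong (scale 1ℚ) (star-natural k)) (sym (relabel-scale P 1ℚ (Arcs.star lift k)))

    waves-lift : ∀ Z {Z'} → Z' ≡ relabel P Z → eastWave w ++ westWave w ++ Z'
                 ≡ relabel P (Arcs.eastWave lift origin ++ Arcs.westWave lift origin ++ Z)
    waves-lift Z refl = sym (begin
      relabel P (LE ++ LW ++ Z)                      ≡⟨ relabel-++ P LE (LW ++ Z) ⟩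
      relabel P LE ++ relabel P (LW ++ Z)            ≡⟨ cong (relabel P LE ++_) (relabel-++ P LW Z) ⟩
      relabel P LE ++ relabel P LW ++ relabel P Z    ≡⟨ cong₂ (λ E W → E ++ W ++ relabel P Z) (eastWave-natural origin) (westWave-natural origin) ⟨
      eastWave w ++ westWave w ++ relabel P Z        ∎)
      where
      LE LW : Formal (Lift × Dir × Side)
      LE = Arcs.eastWave lift origin
      LW = Arcs.westWave lift origin

  waves : Vertex n m → Vertex n m → Bool → Vertex n m → Formal (Arc n m)
  waves x y b w = eastWave x ++ westWave y ++ signed b (standingWave w)

  module _ (w : Vertex n m) where
    private
      open Cover w
      module L = Arcs lift
      module LW = LiftedWaves

    eastWave-evolves : evolve (eastWave w) ≈ eastWave (right w)
    eastWave-evolves = lifted (L.evolve (L.eastWave origin)) (L.eastWave (Moves.east lift origin)) LW.eastWave-evolves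
      (trans (cong evolve (eastWave-natural origin)) (evolve-natural (L.eastWave origin)))
      (eastWave-natural (Moves.east lift origin))

    westWave-evolves : evolve (westWave w) ≈ westWave (left w)
    westWave-evolves = lifted (L.evolve (L.westWave origin)) (L.westWave (Moves.west lift origin)) LW.westWave-evolves
      (trans (cong evolve (westWave-natural origin)) (evolve-natural (L.westWave origin)))
      (westWave-natural (Moves.west lift origin))

    standingWave-evolves : evolve (standingWave w) ≈ neg (standingWave w)
    standingWave-evolves = lifted (L.evolve (L.standingWave origin)) (neg (L.standingWave origin)) LW.standingWave-evolves
      (trans (cong evolve (standingWave-natural origin)) (evolve-natural (L.standingWave origin)))
      (trans (cong neg (standingWave-natural origin)) (sym (relabel-neg P (L.standingWave origin))))

    star-splits : ∀ b → scale 1ℚ (star (flipDown b w)) ≈ waves w w b w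
    star-splits false = lifted (scale 1ℚ (L.star origin)) (L.eastWave origin ++ L.westWave origin ++ L.standingWave origin) LW.star-splits
      (star-lifts origin) (waves-lift (L.standingWave origin) (standingWave-natural origin))
    star-splits true = lifted (scale 1ℚ (L.star (Moves.south lift origin))) (L.eastWave origin ++ L.westWave origin ++ neg (L.standingWave origin))
      LW.star-south-splits (star-lifts (Moves.south lift origin))
      (waves-lift (neg (L.standingWave origin)) (trans (cong neg (standingWave-natural origin)) (sym (relabel-neg P (L.standingWave origin)))))

  signed-standingWave-evolves : ∀ b w → evolve (signed b (standingWave w)) ≈ signed (not b) (standingWave w)
  signed-standingWave-evolves b w = ≈-trans (evolve-signed b (standingWave w))
    (≈-trans (signed-≈ b (standingWave-evolves w)) (signed-neg b (standingWave w)))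

  -- Stated for variables: checking a concrete instance would make Agda evaluate evolve, whose
  -- rational arithmetic is very slow in the type checker.
  waves-evolve : ∀ x y b w → evolve (waves x y b w) ≈ waves (right x) (left y) (not b) w
  waves-evolve x y b w =
    ≈-trans (evolve-++₃ (eastWave x) (westWave y) (signed b (standingWave w)))
      (≈-++ (eastWave-evolves x) (≈-++ (westWave-evolves y) (signed-standingWave-evolves b w)))

  iter-evolve-star : ∀ t w → iter t evolve (scale 1ℚ (star w)) ≈ waves (iter t right w) (iter t left w) (odd t) w
  iter-evolve-star zero    w = star-splits w false
  iter-evolve-star (suc t) w =
    ≈-trans (evolve-≈ (iter-evolve-star t w)) (waves-evolve (iter t right w) (iter t left w) (odd t) w)

  Upow-Ncol : ∀ t w → Upow t (Ncol w) ≗ vec (waves (iter t right w) (iter t left w) (odd t) w)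
  Upow-Ncol t w a = begin
    Upow t (Ncol w) a                          ≡⟨ Upow-cong t (Ncol-star w) a ⟩
    Upow t (vec (scale 1ℚ (star w))) a         ≡⟨ Upow-vec t (scale 1ℚ (star w)) a ⟩
    vec (iter t evolve (scale 1ℚ (star w))) a  ≡⟨ vec-≈ (iter-evolve-star t w) a ⟩
    vec (waves (iter t right w) (iter t left w) (odd t) w) a ∎

  Upow-Ncol-return : ∀ t w → iter t right w ≡ w → Upow t (Ncol w) ≗ Ncol (flipDown (odd t) w)
  Upow-Ncol-return t w right-back a = begin
    Upow t (Ncol w) a                                         ≡⟨ Upow-Ncol t w a ⟩
    vec (waves (iter t right w) (iter t left w) (odd t) w) a  ≡⟨ cong₂ (λ x y → vec (waves x y (odd t) w) a) right-back left-back ⟩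
    vec (waves w w (odd t) w) a                               ≡⟨ vec-≈ (star-splits w (odd t)) a ⟨
    vec (scale 1ℚ (star (flipDown (odd t) w))) a              ≡⟨ Ncol-star (flipDown (odd t) w) a ⟨
    Ncol (flipDown (odd t) w) a                               ∎
    where
    left-back : iter t left w ≡ w
    left-back = trans (cong (iter t left) (sym right-back)) (iter-inverse left-right t w)

module HeightOne {m : ℕ} where

  down-trivial : ∀ (x : Vertex 1 m) → down x ≡ x
  down-trivial (Fin.zero , b) = refl

  open HeightDividingTwo (λ x → trans (cong down (down-trivial x)) (down-trivial x))

  -- In height one down w = w, so the two decompositions of star-splits describe the same vector.
  standingWave-vanishes : ∀ (w : Vertex 1 m) → standingWave w ≈ []
  standingWave-vanishes w = self-negating-vanishes (eastWave w) (westWave w) (standingWave w)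
    (≈-trans (≈-sym (star-splits w false))
      (subst (λ (x : Vertex 1 m) → scale 1ℚ (star x) ≈ waves w w true w) (down-trivial w) (star-splits w true)))

  signed-standingWave-vanishes : ∀ b (w : Vertex 1 m) → signed b (standingWave w) ≈ []
  signed-standingWave-vanishes false w = standingWave-vanishes w
  signed-standingWave-vanishes true  w = ≈-neg (standingWave-vanishes w)

  waves-standing-irrelevant : ∀ x y b w b' w' → waves x y b w ≈ waves x y b' w'
  waves-standing-irrelevant x y b w b' w' = ≈-++ (≈-refl {L = eastWave x}) (≈-++ (≈-refl {L = westWave y})
    (≈-trans (signed-standingWave-vanishes b w) (≈-sym (signed-standingWave-vanishes b' w'))))

  Upow-Ncol-travel : ∀ t w v → iter t right w ≡ v → iter t left w ≡ v → Upow t (Ncol w) ≗ Ncol v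
  Upow-Ncol-travel t w v right-v left-v a = begin
    Upow t (Ncol w) a                                         ≡⟨ Upow-Ncol t w a ⟩
    vec (waves (iter t right w) (iter t left w) (odd t) w) a  ≡⟨ cong₂ (λ x y → vec (waves x y (odd t) w) a) right-v left-v ⟩
    vec (waves v v (odd t) w) a                               ≡⟨ vec-≈ (waves-standing-irrelevant v v (odd t) w false v) a ⟩
    vec (waves v v false v) a                                 ≡⟨ vec-≈ (star-splits v false) a ⟨
    vec (scale 1ℚ (star (flipDown false v))) a                ≡⟨ Ncol-star v a ⟨
    Ncol v a                                                  ∎

periodic-height-1 : ∀ m → Periodic 1 m m
periodic-height-1 m w = HeightOne.Upow-Ncol-travel m w w (iter-right-period w) (iter-left-period w)

pst-height-1 : ∀ l (i : Fin (2 ℕ.* suc l)) → PST {1} {2 ℕ.* suc l} (suc l) (Fin.zero , i) (Fin.zero , cycAdd i (suc l))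
pst-height-1 l i = (λ e → cycAdd-half-≢ l i (cong proj₂ e)) , trans (vDeg-4 w) (sym (vDeg-4 v)) ,
                   HeightOne.Upow-Ncol-travel L w v reach-right reach-left
  where
  L : ℕ
  L = suc l
  w v : Vertex 1 (2 ℕ.* L)
  w = (Fin.zero , i)
  v = (Fin.zero , cycAdd i L)
  reach-right : iter L right w ≡ v
  reach-right = trans (iter-right L Fin.zero i) (cong (Fin.zero ,_) (sym (cycAdd≡iter-cycInc i L)))
  reach-left : iter L left w ≡ v
  reach-left = trans (iter-inverse-half {f = right} {g = left} left-right L w
    (subst (λ k → iter k right w ≡ w) (cong (L ℕ.+_) (ℕₚ.+-identityʳ L)) (iter-right-period w))) reach-right

down-involutive-2 : ∀ {m} (x : Vertex 2 m) → down (down x) ≡ x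
down-involutive-2 (Fin.zero , b) = refl
down-involutive-2 (Fin.suc Fin.zero , b) = refl

module _ {m : ℕ} where
  open HeightDividingTwo {2} {m} down-involutive-2

  periodic-height-2 : ∀ t → 2 ∣ t → (∀ (w : Vertex 2 m) → iter t right w ≡ w) → Periodic 2 m t
  periodic-height-2 t 2∣t right-back w a =
    trans (Upow-Ncol-return t w (right-back w) a) (cong (λ b → Ncol (flipDown b w) a) (odd-even 2∣t))

  pst-height-2 : ¬ (2 ∣ m) → ∀ (i : Fin m) → PST {2} {m} m (Fin.zero , i) (Fin.suc Fin.zero , i)
  pst-height-2 ¬2∣m i = (λ ()) , trans (vDeg-4 w) (sym (vDeg-4 (down w))) , λ a →
    trans (Upow-Ncol-return m w (iter-right-period w) a) (cong (λ b → Ncol (flipDown b w) a) (odd-¬even ¬2∣m))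
    where
    w : Vertex 2 m
    w = (Fin.zero , i)

theorem7p5 :
    ((∀ (m : ℕ) → 1 ≤ m → Periodic 1 m m)
     × (∀ (l : ℕ) → 1 ≤ 2 * l → ∀ (i : Fin (2 * l)) →
          PST {1} {2 * l} l (zero , i) (zero , cycAdd i l)))
    × ((∀ (m : ℕ) → 1 ≤ m → 2 ∣ m → Periodic 2 m m)
     × (∀ (m : ℕ) → 1 ≤ m → ¬ (2 ∣ m) →
          (∀ (i : Fin m) → PST {2} {m} m (zero , i) (suc zero , i))
          × Periodic 2 m (2 * m)))
theorem7p5 =
  ( (λ m _ → periodic-height-1 m)
  , λ { (suc l) _ → pst-height-1 l } )
  , ( (λ m _ 2∣m → periodic-height-2 m 2∣m iter-right-period)
    , λ m _ ¬2∣m → pst-height-2 ¬2∣m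
                 , periodic-height-2 (2 * m) (m∣m*n m) (iter-periodic-* right m iter-right-period 2) )
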